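{- Let $p$ be a prime, $a\ge 1$ an integer and $b=p^a$. Then the sequence $\left(\ell_b(n!)\right)_{n\in\mathbb{N}}$ is $b$-automatic.
   Context: For an integer $b\ge 2$ and a positive integer $m$, $\ell_b(m)$ denotes the last nonzero digit of $m$ in base $b$, i.e. $\ell_b(m)\in\{1,\dots,b-1\}$ with $\ell_b(m)\equiv m/b^{v_b(m)}\pmod b$, where $v_b(m)$ is the largest $t$ with $b^t\mid m$. A deterministic finite automaton with output (DFAO) is a tuple $(Q,\Sigma,\rho,q_0,\Delta,\tau)$ with $Q$ finite, $\Sigma$ a finite input alphabet, $\rho:Q\times\Sigma\to Q$ (extended to words letter by letter), $q_0\in Q$, $\Delta$ a finite output alphabet and $\tau:Q\to\Delta$. A sequence $(a(n))_{n\in\mathbb{N}}$ is $k$-automatic if there is a DFAO with input alphabet $\{0,\dots,k-1\}$ such that $a(n)=\tau(\rho(q_0,[n]_k))$ for all $n$, where $[n]_k$ is the string of base-$k$ digits of $n$ (the reading direction does not affect this notion). -}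

module Defs where

open import Data.Nat using (ℕ; zero; suc; _+_; _*_; _≤_; _<_; NonZero; _≟_)
open import Data.Nat.DivMod using (_/_; _%_)
open import Data.Product using (Σ)
open import Relation.Binary.PropositionalEquality using (_≡_)
open import Data.Fin using (Fin; fromℕ<)
open import Data.Nat.DivMod using (m%n<n)
open import Data.List using (List; []; _∷_; foldl; reverse)
open import Relation.Nullary using (yes; no)

-- Remove all factors b from m: m / b^{v_b(m)}  (for m ≥ 1).
-- The fuel argument f bounds the number of divisions (v_b(m) ≤ m, so fuel m suffices).
stripB : (b : ℕ) .{{_ : NonZero b}} → ℕ → ℕ → ℕ
stripB b zero    m = m
stripB b (suc f) zero = zero
stripB b (suc f) (suc m) with (suc m) % b ≟ 0
... | yes _ = stripB b f (suc m / b)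
... | no  _ = suc m

-- ℓ_b(m): last nonzero base-b digit of m (meaningful for m ≥ 1; gives 0 for m = 0)
lastNZ : (b : ℕ) .{{_ : NonZero b}} → ℕ → ℕ
lastNZ b m = stripB b m m % b

digitB : (b : ℕ) .{{_ : NonZero b}} → ℕ → Fin b
digitB b n = fromℕ< (m%n<n n b)

-- Base-b digits of n, least significant first ([0]_b is the empty word).
-- fuel f ≥ n suffices when b ≥ 2.
digitsLSD : (b : ℕ) .{{_ : NonZero b}} → ℕ → ℕ → List (Fin b)
digitsLSD b zero    n = []
digitsLSD b (suc f) zero = []
digitsLSD b (suc f) (suc n) = digitB b (suc n) ∷ digitsLSD b f (suc n / b)

digits : (b : ℕ) .{{_ : NonZero b}} → ℕ → List (Fin b)
digits b n = reverse (digitsLSD b n n)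

record DFAO (k : ℕ) (Δ : Set) : Set where
  field
    numStates : ℕ
    ρ         : Fin numStates → Fin k → Fin numStates
    q₀        : Fin numStates
    τ         : Fin numStates → Δ

  ρ* : Fin numStates → List (Fin k) → Fin numStates
  ρ* = foldl ρ

-- a : ℕ → ℕ is k-automatic (most-significant-digit-first reading)
IsAutomatic : (k : ℕ) .{{_ : NonZero k}} → (ℕ → ℕ) → Set
IsAutomatic k a =
  Σ (DFAO k ℕ) λ M → ∀ n → DFAO.τ M (DFAO.ρ* M (DFAO.q₀ M) (digits k n)) ≡ a n

module Submission where

-- Write n! = p^V · F with p ∤ F.  Since b = p^a, ℓ_b(n!) = (p^(V mod a) · F) mod b, so it
-- suffices to follow V mod a and F mod b while the base-b digits of n are read from the most
-- significant end, i.e. along n ↦ b·n + d.  Let G(m) = ∏_{k ≤ m, p ∤ k} k.  Then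
-- m! = G(m) · p^⌊m/p⌋ · ⌊m/p⌋!, and applying this a times to b·n + d gives
--   (b·n + d)! = p^S · H · n!,  S = Σ_{j=1..a} ⌊(b·n + d)/p^j⌋,  H = ∏_{j<a} G(⌊(b·n + d)/p^j⌋).
-- S mod a depends only on n mod a and d.  By the periodicity G(x) ≡ G(b)^⌊x/b⌋ · G(x mod b)
-- (mod b), H mod b depends only on n mod b, d and the residues G(b)^⌊n/p^i⌋ mod b (i < a),
-- which are themselves updated digit by digit.  These residues form a finite state.

open import Data.Nat
open import Data.Nat.Properties
open import Data.Nat.DivMod
open import Data.Nat.Divisibility
open import Data.Nat.Primality
open import Data.Nat.Induction using (<-rec)
open import Data.Nat.Tactic.RingSolver using (solve-∀)
open import Data.Product using (_×_; _,_; proj₁; proj₂; map₂)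
open import Data.Sum using (_⊎_; inj₁; inj₂; [_,_]′)
open import Data.Empty using (⊥-elim)
open import Relation.Nullary using (¬_; yes; no)
open import Relation.Binary.PropositionalEquality hiding ([_])
open import Data.Fin using (Fin; toℕ; fromℕ<; combine; remQuot) renaming (zero to fzero)
open import Data.Fin.Properties using (toℕ-fromℕ<; toℕ<n; remQuot-combine)
open import Data.List using (_∷_; _++_; reverse; [_])
open import Data.List.Properties using (foldl-++; unfold-reverse)
open import Defs

module _ {d : ℕ} .{{_ : NonZero d}} where

  +-cong-% : ∀ {x x' y y'} → x % d ≡ x' % d → y % d ≡ y' % d → (x + y) % d ≡ (x' + y') % d
  +-cong-% {x} {x'} {y} {y'} ex ey = begin
    (x + y) % d            ≡⟨ %-distribˡ-+ x y d ⟩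
    (x % d + y % d) % d    ≡⟨ cong₂ (λ u v → (u + v) % d) ex ey ⟩
    (x' % d + y' % d) % d  ≡⟨ %-distribˡ-+ x' y' d ⟨
    (x' + y') % d          ∎
    where open ≡-Reasoning

  *-cong-% : ∀ {x x' y y'} → x % d ≡ x' % d → y % d ≡ y' % d → (x * y) % d ≡ (x' * y') % d
  *-cong-% {x} {x'} {y} {y'} ex ey = begin
    (x * y) % d            ≡⟨ %-distribˡ-* x y d ⟩
    (x % d * (y % d)) % d  ≡⟨ cong₂ (λ u v → (u * v) % d) ex ey ⟩
    (x' % d * (y' % d)) % d ≡⟨ %-distribˡ-* x' y' d ⟨
    (x' * y') % d          ∎
    where open ≡-Reasoning

  ^-cong-% : ∀ {x x'} k → x % d ≡ x' % d → (x ^ k) % d ≡ (x' ^ k) % d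
  ^-cong-% zero    e = refl
  ^-cong-% (suc k) e = *-cong-% e (^-cong-% k e)

%-cong-∣ : ∀ {m n x y} .{{_ : NonZero m}} .{{_ : NonZero n}} →
           m ∣ n → x % n ≡ y % n → x % m ≡ y % m
%-cong-∣ {m} {n} {x} {y} m∣n e =
  trans (sym (m∣n⇒o%n%m≡o%m m n x m∣n)) (trans (cong (_% m) e) (m∣n⇒o%n%m≡o%m m n y m∣n))

[e+kn]/n≡e/n+k : ∀ {n} .{{_ : NonZero n}} e k → (e + k * n) / n ≡ e / n + k
[e+kn]/n≡e/n+k {n} e k = trans (+-distrib-/-∣ʳ e (divides-refl k)) (cong (e / n +_) (m*n/n≡m k n))

[r+qn]/n≡q : ∀ {n} .{{_ : NonZero n}} r q → r < n → (r + q * n) / n ≡ q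
[r+qn]/n≡q r q r<n = trans ([e+kn]/n≡e/n+k r q) (cong (_+ q) (m<n⇒m/n≡0 r<n))

suc-/-cases : ∀ {n} .{{_ : NonZero n}} m →
              (¬ n ∣ suc m × suc m / n ≡ m / n) ⊎ (suc m ≡ suc (m / n) * n)
suc-/-cases {n} m with m≤n⇒m<n∨m≡n (m%n<n m n)
... | inj₂ last = inj₂ (trans expand (cong (_+ (m / n) * n) last))
  where
    expand : suc m ≡ suc (m % n) + (m / n) * n
    expand = cong suc (m≡m%n+[m/n]*n m n)
... | inj₁ lt = inj₁ (n∤ , trans (/-congˡ expand) ([r+qn]/n≡q (suc (m % n)) (m / n) lt))
  where
    open ≡-Reasoning
    expand : suc m ≡ suc (m % n) + (m / n) * n
    expand = cong suc (m≡m%n+[m/n]*n m n)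
    n∤ : ¬ n ∣ suc m
    n∤ n∣ = 0≢1+n (begin
      0                             ≡⟨ n∣m⇒m%n≡0 (suc m) n n∣ ⟨
      suc m % n                     ≡⟨ %-congˡ expand ⟩
      (suc (m % n) + m / n * n) % n ≡⟨ [m+kn]%n≡m%n (suc (m % n)) (m / n) n ⟩
      suc (m % n) % n               ≡⟨ m<n⇒m%n≡m lt ⟩
      suc (m % n)                   ∎)

residue : (n : ℕ) .{{_ : NonZero n}} → ℕ → Fin n
residue n x = fromℕ< (m%n<n x n)

toℕ-residue : ∀ n .{{_ : NonZero n}} x → toℕ (residue n x) ≡ x % n
toℕ-residue n x = toℕ-fromℕ< (m%n<n x n)

module Packing (m : ℕ) .{{_ : NonZero m}} where

  pack : (k : ℕ) → (ℕ → ℕ) → Fin (m ^ k)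
  pack zero    Y = fzero
  pack (suc k) Y = combine (residue m (Y 0)) (pack k (λ i → Y (suc i)))

  unpack : (k : ℕ) → Fin (m ^ k) → ℕ → ℕ
  unpack zero    c i       = 0
  unpack (suc k) c zero    = toℕ (proj₁ (remQuot {m} (m ^ k) c))
  unpack (suc k) c (suc i) = unpack k (proj₂ (remQuot {m} (m ^ k) c)) i

  unpack-pack : ∀ k Y i → i < k → unpack k (pack k Y) i ≡ Y i % m
  unpack-pack (suc k) Y zero _ =
    trans (cong (λ z → toℕ (proj₁ z)) (remQuot-combine (residue m (Y 0)) (pack k (λ i → Y (suc i)))))
          (toℕ-residue m (Y 0))
  unpack-pack (suc k) Y (suc i) (s≤s i<k) =
    trans (cong (λ z → unpack k (proj₂ z) i) (remQuot-combine (residue m (Y 0)) (pack k (λ i → Y (suc i)))))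
          (unpack-pack k (λ i → Y (suc i)) i i<k)

module Base (b : ℕ) .{{_ : NonZero b}} (1<b : 1 < b) where

  -- Removing the last digit of suc k leaves a number ≤ k; this bounds the fuel needed.
  suc-/-≤ : ∀ k → suc k / b ≤ k
  suc-/-≤ k = s≤s⁻¹ (m/n<m (suc k) b 1<b)

  digitsLSD-fuel : ∀ f g x → x ≤ f → x ≤ g → digitsLSD b f x ≡ digitsLSD b g x
  digitsLSD-fuel zero    zero    zero _ _ = refl
  digitsLSD-fuel zero    (suc g) zero _ _ = refl
  digitsLSD-fuel (suc f) zero    zero _ _ = refl
  digitsLSD-fuel (suc f) (suc g) zero _ _ = refl
  digitsLSD-fuel (suc f) (suc g) (suc y) (s≤s y≤f) (s≤s y≤g) =
    cong (digitB b (suc y) ∷_) (digitsLSD-fuel f g (suc y / b)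
      (≤-trans (suc-/-≤ y) y≤f) (≤-trans (suc-/-≤ y) y≤g))

  digits-suc : ∀ k → digits b (suc k) ≡ digits b (suc k / b) ++ [ digitB b (suc k) ]
  digits-suc k = trans (unfold-reverse (digitB b (suc k)) (digitsLSD b k (suc k / b)))
    (cong (λ z → reverse z ++ [ digitB b (suc k) ])
          (digitsLSD-fuel k (suc k / b) (suc k / b) (suc-/-≤ k) ≤-refl))

  digit-decomposition : ∀ n → b * (n / b) + toℕ (digitB b n) ≡ n
  digit-decomposition n = begin
    b * (n / b) + toℕ (digitB b n) ≡⟨ cong₂ _+_ (*-comm b (n / b)) (toℕ-residue b n) ⟩
    n / b * b + n % b              ≡⟨ +-comm (n / b * b) (n % b) ⟩
    n % b + n / b * b              ≡⟨ m≡m%n+[m/n]*n n b ⟨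
    n                              ∎
    where open ≡-Reasoning

  automatic-by-invariant :
    ∀ {S : Set} {f : ℕ → ℕ} (N : ℕ) (encode : S → Fin N) (decode : Fin N → S)
      (δ : S → Fin b → S) (s₀ : S) (out : S → ℕ) (R : ℕ → S → Set) →
    (∀ {n s} → R n s → R n (decode (encode s))) →
    R 0 s₀ →
    (∀ {n s} d → R n s → R (b * n + toℕ d) (δ s d)) →
    (∀ {n s} → R n s → out s ≡ f n) →
    IsAutomatic b f
  automatic-by-invariant N encode decode δ s₀ out R compress init step output =
    M , λ n → output (tracks n)
    where
      M : DFAO b ℕ
      M = record { numStates = N ; ρ = λ q d → encode (δ (decode q) d) ; q₀ = encode s₀
                 ; τ = λ q → out (decode q) }

      run : ℕ → Fin N
      run n = DFAO.ρ* M (encode s₀) (digits b n)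

      run-suc : ∀ k → run (suc k) ≡ DFAO.ρ M (run (suc k / b)) (digitB b (suc k))
      run-suc k = trans (cong (DFAO.ρ* M (encode s₀)) (digits-suc k))
                        (foldl-++ (DFAO.ρ M) (encode s₀) (digits b (suc k / b)) [ digitB b (suc k) ])

      tracks : ∀ n → R n (decode (run n))
      tracks = <-rec (λ n → R n (decode (run n))) go
        where
          go : ∀ n → (∀ {m} → m < n → R m (decode (run m))) → R n (decode (run n))
          go zero    _  = compress init
          go (suc k) ih = subst (λ q → R (suc k) (decode q)) (sym (run-suc k)) (compress stepped)
            where
              m = suc k / b
              d = digitB b (suc k)
              stepped : R (suc k) (δ (decode (run m)) d)
              stepped = subst (λ n → R n (δ (decode (run m)) d)) (digit-decomposition (suc k))
                              (step d (ih (s≤s (suc-/-≤ k))))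

  ∤⇒NonZero : ∀ {w} → ¬ b ∣ w → NonZero w
  ∤⇒NonZero {zero}  b∤w = ⊥-elim (b∤w (b ∣0))
  ∤⇒NonZero {suc _} _   = _

  stripB-unit : ∀ f x → ¬ b ∣ x → stripB b f x ≡ x
  stripB-unit zero    x       _   = refl
  stripB-unit (suc f) zero    b∤x = ⊥-elim (b∤x (b ∣0))
  stripB-unit (suc f) (suc m) b∤x with suc m % b ≟ 0
  ... | yes ≡0 = ⊥-elim (b∤x (m%n≡0⇒n∣m (suc m) b ≡0))
  ... | no  _  = refl

  stripB-step : ∀ f x .{{_ : NonZero x}} → stripB b (suc f) (x * b) ≡ stripB b f x
  stripB-step f x with x * b in eq
  ... | zero  = ⊥-elim (≢-nonZero⁻¹ (x * b) {{m*n≢0 x b}} eq)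
  ... | suc m with suc m % b ≟ 0
  ...   | yes _  = cong (stripB b f) (trans (/-congˡ (sym eq)) (m*n/n≡m x b))
  ...   | no ≢0 = ⊥-elim (≢0 (trans (%-congˡ (sym eq)) (m*n%n≡0 x b)))

  stripB-pow : ∀ q f w → q ≤ f → ¬ b ∣ w → stripB b f (b ^ q * w) ≡ w
  stripB-pow zero    f       w _         b∤w =
    trans (cong (stripB b f) (*-identityˡ w)) (stripB-unit f w b∤w)
  stripB-pow (suc q) (suc f) w (s≤s q≤f) b∤w = begin
    stripB b (suc f) (b ^ suc q * w)   ≡⟨ cong (stripB b (suc f)) (reorder b (b ^ q) w) ⟩
    stripB b (suc f) ((b ^ q * w) * b) ≡⟨ stripB-step f (b ^ q * w) {{b^q*w≢0}} ⟩
    stripB b f (b ^ q * w)             ≡⟨ stripB-pow q f w q≤f b∤w ⟩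
    w                                  ∎
    where
      open ≡-Reasoning
      reorder : ∀ x y z → x * y * z ≡ y * z * x
      reorder = solve-∀
      b^q*w≢0 : NonZero (b ^ q * w)
      b^q*w≢0 = m*n≢0 (b ^ q) w {{m^n≢0 b q}} {{∤⇒NonZero b∤w}}

  -- The fuel lastNZ uses for b^q·w is at least q.
  n<b^n : ∀ n → n < b ^ n
  n<b^n zero    = s≤s z≤n
  n<b^n (suc n) =
    ≤-<-trans (n<b^n n) (subst (b ^ n <_) (*-comm (b ^ n) b) (m<m*n (b ^ n) b {{m^n≢0 b n}} 1<b))

  lastNZ-pow-mul : ∀ q w → ¬ b ∣ w → lastNZ b (b ^ q * w) ≡ w % b
  lastNZ-pow-mul q w b∤w = cong (_% b) (stripB-pow q (b ^ q * w) w q≤ b∤w)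
    where
      q≤ : q ≤ b ^ q * w
      q≤ = ≤-trans (<⇒≤ (n<b^n q)) (m≤m*n (b ^ q) w {{∤⇒NonZero b∤w}})

module CoprimeFactorial (p : ℕ) (pr : Prime p) where

  instance
    p≢0 : NonZero p
    p≢0 = prime⇒nonZero pr

  coprimePart : ℕ → ℕ
  coprimePart k with p ∣? k
  ... | yes _ = 1
  ... | no  _ = k

  coprimeFactorial : ℕ → ℕ
  coprimeFactorial zero    = 1
  coprimeFactorial (suc k) = coprimeFactorial k * coprimePart (suc k)

  coprimePart-∤ : ∀ {k} → ¬ p ∣ k → coprimePart k ≡ k
  coprimePart-∤ {k} p∤k with p ∣? k
  ... | yes p∣k = ⊥-elim (p∤k p∣k)
  ... | no  _   = refl

  coprimePart-∣ : ∀ {k} → p ∣ k → coprimePart k ≡ 1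
  coprimePart-∣ {k} p∣k with p ∣? k
  ... | yes _   = refl
  ... | no  p∤k = ⊥-elim (p∤k p∣k)

  -- m! = G(m) · p^⌊m/p⌋ · ⌊m/p⌋!: the multiples of p up to m are p·1, …, p·⌊m/p⌋.
  factorial-split : ∀ m → m ! ≡ coprimeFactorial m * (p ^ (m / p) * (m / p) !)
  factorial-split zero rewrite 0/n≡0 p {{p≢0}} = refl
  factorial-split (suc m) with suc-/-cases {p} m
  ... | inj₁ (p∤ , same) = begin
    suc m * m !                                           ≡⟨ cong (suc m *_) (factorial-split m) ⟩
    suc m * (G m * (p ^ (m / p) * (m / p) !))            ≡⟨ swap (suc m) (G m) _ ⟩
    G m * suc m * (p ^ (m / p) * (m / p) !)              ≡⟨ cong₂ (λ c q → G m * c * (p ^ q * q !))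
                                                                  (sym (coprimePart-∤ p∤)) (sym same) ⟩
    G m * coprimePart (suc m) * (p ^ (suc m / p) * (suc m / p) !) ∎
    where
      open ≡-Reasoning
      G = coprimeFactorial
      swap : ∀ s g y → s * (g * y) ≡ g * s * y
      swap = solve-∀
  ... | inj₂ next = begin
    suc m * m !                                           ≡⟨ cong₂ _*_ next (factorial-split m) ⟩
    suc q * p * (G m * (p ^ q * q !))                     ≡⟨ regroup (suc q) p (G m) (p ^ q) (q !) ⟩
    G m * 1 * (p * p ^ q * (suc q * q !))                 ≡⟨ cong₂ (λ c r → G m * c * (p ^ r * r !))
                                                                  (sym (coprimePart-∣ (divides (suc q) next)))
                                                                  (sym quotient-suc) ⟩
    G m * coprimePart (suc m) * (p ^ (suc m / p) * (suc m / p) !) ∎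
    where
      open ≡-Reasoning
      G = coprimeFactorial
      q = m / p
      quotient-suc : suc m / p ≡ suc q
      quotient-suc = trans (/-congˡ next) (m*n/n≡m (suc q) p)
      regroup : ∀ s p g x f → s * p * (g * (x * f)) ≡ g * 1 * (p * x * (s * f))
      regroup = solve-∀

  p∤1 : ¬ p ∣ 1
  p∤1 p∣1 = <-irrefl (sym (∣1⇒≡1 p∣1)) (nonTrivial⇒n>1 p {{prime⇒nonTrivial pr}})

  p∤* : ∀ {x y} → ¬ p ∣ x → ¬ p ∣ y → ¬ p ∣ x * y
  p∤* {x} {y} p∤x p∤y p∣xy = [ p∤x , p∤y ]′ (euclidsLemma x y pr p∣xy)

  coprimePart-coprime : ∀ k → ¬ p ∣ coprimePart k
  coprimePart-coprime k with p ∣? k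
  ... | yes _   = p∤1
  ... | no  p∤k = p∤k

  coprimeFactorial-coprime : ∀ m → ¬ p ∣ coprimeFactorial m
  coprimeFactorial-coprime zero    = p∤1
  coprimeFactorial-coprime (suc m) = p∤* (coprimeFactorial-coprime m) (coprimePart-coprime (suc m))

  -- Periodicity modulo any multiple M of p: shifting by M changes neither divisibility by p
  -- nor residues, so G(r + q·M) ≡ G(q·M)·G(r) and G(q·M) ≡ G(M)^q (mod M).
  module Periodic (M : ℕ) .{{_ : NonZero M}} (p∣M : p ∣ M) where

    coprimePart-shift : ∀ r q → coprimePart (r + q * M) % M ≡ coprimePart r % M
    coprimePart-shift r q with p ∣? (r + q * M) | p ∣? r
    ... | yes _   | yes _   = refl
    ... | no  _   | no  _   = [m+kn]%n≡m%n r q M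
    ... | yes p∣  | no  p∤r = ⊥-elim (p∤r (∣m+n∣m⇒∣n (subst (p ∣_) (+-comm r (q * M)) p∣) p∣qM))
      where p∣qM = ∣n⇒∣m*n q p∣M
    ... | no  p∤  | yes p∣r = ⊥-elim (p∤ (∣m∣n⇒∣m+n p∣r (∣n⇒∣m*n q p∣M)))

    coprimeFactorial-shift : ∀ r q →
      coprimeFactorial (r + q * M) % M ≡ (coprimeFactorial (q * M) * coprimeFactorial r) % M
    coprimeFactorial-shift zero    q = cong (_% M) (sym (*-identityʳ (coprimeFactorial (q * M))))
    coprimeFactorial-shift (suc r) q =
      trans (*-cong-% {d = M} (coprimeFactorial-shift r q) (coprimePart-shift (suc r) q))
            (cong (_% M) (*-assoc (coprimeFactorial (q * M)) (coprimeFactorial r) (coprimePart (suc r))))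

    coprimeFactorial-multiple : ∀ q → coprimeFactorial (q * M) % M ≡ (coprimeFactorial M ^ q) % M
    coprimeFactorial-multiple zero    = refl
    coprimeFactorial-multiple (suc q) =
      trans (coprimeFactorial-shift M q)
            (trans (*-cong-% {d = M} (coprimeFactorial-multiple q) refl)
                   (cong (_% M) (*-comm (coprimeFactorial M ^ q) (coprimeFactorial M))))

    coprimeFactorial-mod : ∀ x →
      coprimeFactorial x % M ≡ (coprimeFactorial M ^ (x / M) * coprimeFactorial (x % M)) % M
    coprimeFactorial-mod x =
      trans (cong (λ y → coprimeFactorial y % M) (m≡m%n+[m/n]*n x M))
            (trans (coprimeFactorial-shift (x % M) (x / M))
                   (*-cong-% {d = M} (coprimeFactorial-multiple (x / M)) refl))

  -- Iterating factorial-split j times on p^j·n + e with e < p^j.  The exponent collects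
  -- Σ_{i=1..j} ⌊(p^j·n + e)/p^i⌋ and the coprime factor the values G(⌊(p^j·n + e)/p^i⌋), i < j.
  legendreSum : ℕ → ℕ → ℕ → ℕ
  legendreSum zero    n e = 0
  legendreSum (suc j) n e = (p ^ j * n + e / p) + legendreSum j n (e / p)

  coprimeProduct : ℕ → ℕ → ℕ → ℕ
  coprimeProduct zero    n e = 1
  coprimeProduct (suc j) n e = coprimeFactorial (p ^ suc j * n + e) * coprimeProduct j n (e / p)

  shift-/p : ∀ j n e → (p ^ suc j * n + e) / p ≡ p ^ j * n + e / p
  shift-/p j n e = begin
    (p ^ suc j * n + e) / p   ≡⟨ /-congˡ (reorder p (p ^ j) n e) ⟩
    (e + p ^ j * n * p) / p   ≡⟨ [e+kn]/n≡e/n+k e (p ^ j * n) ⟩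
    e / p + p ^ j * n         ≡⟨ +-comm (e / p) (p ^ j * n) ⟩
    p ^ j * n + e / p         ∎
    where
      open ≡-Reasoning
      reorder : ∀ p y n e → p * y * n + e ≡ e + y * n * p
      reorder = solve-∀

  /p<p^ : ∀ j e → e < p ^ suc j → e / p < p ^ j
  /p<p^ j e e< = m<n*o⇒m/o<n (subst (e <_) (*-comm p (p ^ j)) e<)

  factorial-iterate : ∀ j n e → e < p ^ j →
    (p ^ j * n + e) ! ≡ p ^ legendreSum j n e * (coprimeProduct j n e * n !)
  factorial-iterate zero n zero _ =
    trans (cong _! (trans (+-identityʳ _) (*-identityˡ n))) (sym (trans (*-identityˡ _) (*-identityˡ _)))
  factorial-iterate zero n (suc e) (s≤s ())
  factorial-iterate (suc j) n e e< = begin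
    x !                                       ≡⟨ factorial-split x ⟩
    G x * (p ^ (x / p) * (x / p) !)           ≡⟨ cong (λ z → G x * (p ^ z * z !)) (shift-/p j n e) ⟩
    G x * (p ^ y * y !)                       ≡⟨ cong (λ z → G x * (p ^ y * z))
                                                      (factorial-iterate j n (e / p) (/p<p^ j e e<)) ⟩
    G x * (p ^ y * (p ^ S * (H * n !)))       ≡⟨ regroup (G x) (p ^ y) (p ^ S) H (n !) ⟩
    (p ^ y * p ^ S) * ((G x * H) * n !)       ≡⟨ cong (_* ((G x * H) * n !)) (^-distribˡ-+-* p y S) ⟨
    p ^ (y + S) * ((G x * H) * n !)           ∎
    where
      open ≡-Reasoning
      G = coprimeFactorial
      x = p ^ suc j * n + e
      y = p ^ j * n + e / p
      S = legendreSum j n (e / p)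
      H = coprimeProduct j n (e / p)
      regroup : ∀ g u v h f → g * (u * (v * (h * f))) ≡ (u * v) * ((g * h) * f)
      regroup = solve-∀

  coprimeProduct-coprime : ∀ j n e → ¬ p ∣ coprimeProduct j n e
  coprimeProduct-coprime zero    n e = p∤1
  coprimeProduct-coprime (suc j) n e =
    p∤* (coprimeFactorial-coprime (p ^ suc j * n + e)) (coprimeProduct-coprime j n (e / p))

module PrimePower (p a : ℕ) (pr : Prime p) (a≥1 : a ≥ 1) where
  open CoprimeFactorial p pr

  b : ℕ
  b = p ^ a

  instance
    a≢0 : NonZero a
    a≢0 = >-nonZero a≥1
    b≢0 : NonZero b
    b≢0 = m^n≢0 p a
    ab≢0 : NonZero (a * b)
    ab≢0 = m*n≢0 a b

  p^≢0 : ∀ k → NonZero (p ^ k)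
  p^≢0 k = m^n≢0 p k

  1<b : 1 < b
  1<b = <-≤-trans (nonTrivial⇒n>1 p {{prime⇒nonTrivial pr}})
                  (subst (_≤ b) (*-identityʳ p) (^-monoʳ-≤ p a≥1))

  open Base b 1<b using (automatic-by-invariant; lastNZ-pow-mul)
  open Packing b using (pack; unpack; unpack-pack)

  -- ⌊n / p^i⌋, the number whose residues G(b)^⌊n/p^i⌋ the automaton stores.
  _/p^_ : ℕ → ℕ → ℕ
  n /p^ i = _/_ n (p ^ i) {{p^≢0 i}}

  -- p ∣ b since a ≥ 1, so G is periodic modulo b.
  p∣b : p ∣ b
  p∣b = subst (λ k → p ∣ p ^ k) (m+[n∸m]≡n a≥1) (m∣m*n (p ^ (a ∸ 1)))

  -- G(b), the period factor of the coprime factorial modulo b.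
  P : ℕ
  P = coprimeFactorial b

  open Periodic b p∣b using (coprimeFactorial-mod)

  b≡p^k*p^[a∸k] : ∀ k → k ≤ a → b ≡ p ^ k * p ^ (a ∸ k)
  b≡p^k*p^[a∸k] k k≤a = trans (cong (p ^_) (sym (m+[n∸m]≡n k≤a))) (^-distribˡ-+-* p k (a ∸ k))

  b∤p^r*F : ∀ r F → r < a → ¬ p ∣ F → ¬ b ∣ p ^ r * F
  b∤p^r*F r F r<a p∤F b∣ = p∤F (∣-trans p∣p^[a∸r]
    (*-cancelˡ-∣ (p ^ r) {{p^≢0 r}} (subst (_∣ p ^ r * F) (b≡p^k*p^[a∸k] r (<⇒≤ r<a)) b∣)))
    where
      p∣p^[a∸r] : p ∣ p ^ (a ∸ r)
      p∣p^[a∸r] = subst (λ k → p ∣ p ^ k) (m+[n∸m]≡n (m<n⇒0<n∸m r<a)) (m∣m*n (p ^ (a ∸ r ∸ 1)))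

  lastNZ-factorization : ∀ V F → ¬ p ∣ F → lastNZ b (p ^ V * F) ≡ (p ^ (V % a) * F) % b
  lastNZ-factorization V F p∤F = begin
    lastNZ b (p ^ V * F)                     ≡⟨ cong (lastNZ b) split ⟩
    lastNZ b (b ^ (V / a) * (p ^ r * F))     ≡⟨ lastNZ-pow-mul (V / a) (p ^ r * F)
                                                  (b∤p^r*F r F (m%n<n V a) p∤F) ⟩
    (p ^ r * F) % b                          ∎
    where
      open ≡-Reasoning
      r = V % a
      reorder : ∀ x y z → x * y * z ≡ y * (x * z)
      reorder = solve-∀
      split : p ^ V * F ≡ b ^ (V / a) * (p ^ r * F)
      split = begin
        p ^ V * F                  ≡⟨ cong (λ z → p ^ z * F) (m≡m%n+[m/n]*n V a) ⟩
        p ^ (r + V / a * a) * F    ≡⟨ cong (_* F) (^-distribˡ-+-* p r (V / a * a)) ⟩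
        p ^ r * p ^ (V / a * a) * F ≡⟨ cong (λ z → p ^ r * z * F)
                                          (trans (cong (p ^_) (*-comm (V / a) a)) (sym (^-*-assoc p a (V / a)))) ⟩
        p ^ r * b ^ (V / a) * F    ≡⟨ reorder (p ^ r) (b ^ (V / a)) F ⟩
        b ^ (V / a) * (p ^ r * F)  ∎

  legendreSum-mod : ∀ j n r e → n % a ≡ r % a → legendreSum j n e % a ≡ legendreSum j r e % a
  legendreSum-mod zero    n r e _ = refl
  legendreSum-mod (suc j) n r e n≡r =
    +-cong-% {d = a} (+-cong-% {d = a} (*-cong-% {d = a} {x = p ^ j} refl n≡r) refl)
                     (legendreSum-mod j n r (e / p) n≡r)

  quotient-by-b : ∀ k n e → k ≤ a → e < p ^ k → (p ^ k * n + e) / b ≡ n /p^ (a ∸ k)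
  quotient-by-b k n e k≤a e< = begin
    x / b                             ≡⟨ /-congʳ (b≡p^k*p^[a∸k] k k≤a) ⟩
    x / (p ^ k * p ^ (a ∸ k))         ≡⟨ m/n/o≡m/[n*o] x (p ^ k) (p ^ (a ∸ k)) ⟨
    x / p ^ k / p ^ (a ∸ k)           ≡⟨ cong (_/ p ^ (a ∸ k)) x/p^k ⟩
    n /p^ (a ∸ k)                     ∎
    where
      open ≡-Reasoning
      instance
        _ = p^≢0 k
        _ = p^≢0 (a ∸ k)
        _ = m*n≢0 (p ^ k) (p ^ (a ∸ k))
      x = p ^ k * n + e
      x/p^k : x / p ^ k ≡ n
      x/p^k = trans (/-congˡ (trans (+-comm (p ^ k * n) e) (cong (e +_) (*-comm (p ^ k) n))))
                    ([r+qn]/n≡q e n e<)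

  -- The coprime factor of a digit step, computed from the residues that the automaton
  -- stores: r ≡ n (mod b) and Y i ≡ P^⌊n/p^i⌋ (mod b).
  coprimeProductModel : ℕ → ℕ → (ℕ → ℕ) → ℕ → ℕ
  coprimeProductModel zero    r Y e = 1
  coprimeProductModel (suc j) r Y e =
    (Y (a ∸ suc j) * coprimeFactorial ((p ^ suc j * r + e) % b)) * coprimeProductModel j r Y (e / p)

  -- It agrees with the true coprime factor modulo b: by the periodicity of G, each factor
  -- G(p^j·n + e) is P^⌊n/p^(a-j)⌋ · G((p^j·n + e) mod b) modulo b.
  coprimeProduct-mod : ∀ j n r Y e → j ≤ a → e < p ^ j → n % b ≡ r % b →
    (∀ i → i < a → Y i % b ≡ P ^ (n /p^ i) % b) →
    coprimeProduct j n e % b ≡ coprimeProductModel j r Y e % b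
  coprimeProduct-mod zero    n r Y e _   _  _   _  = refl
  coprimeProduct-mod (suc j) n r Y e j<a e< n≡r Y≡ =
    *-cong-% {d = b} G≡
      (coprimeProduct-mod j n r Y (e / p) (≤-trans (n≤1+n j) j<a) (/p<p^ j e e<) n≡r Y≡)
    where
      x = p ^ suc j * n + e
      i = a ∸ suc j
      i<a : i < a
      i<a = m<n+o⇒m∸n<o a (suc j) (m<n+m a (s≤s z≤n))
      x≡ : x % b ≡ (p ^ suc j * r + e) % b
      x≡ = +-cong-% {d = b} (*-cong-% {d = b} {x = p ^ suc j} refl n≡r) refl
      G≡ : coprimeFactorial x % b ≡ (Y i * coprimeFactorial ((p ^ suc j * r + e) % b)) % b
      G≡ = trans (coprimeFactorial-mod x)
                 (*-cong-% {d = b} (trans (cong (λ z → P ^ z % b) (quotient-by-b (suc j) n e j<a e<))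
                                          (sym (Y≡ i i<a)))
                           (cong (λ z → coprimeFactorial z % b) x≡))

  quotient-step : ∀ n d i → i < a → (b * n + d) /p^ i ≡ d /p^ i + p ^ (a ∸ i) * n
  quotient-step n d i i<a =
    trans (cong (_/p^ i) expand) ([e+kn]/n≡e/n+k {p ^ i} {{p^≢0 i}} d (p ^ (a ∸ i) * n))
    where
      reorder : ∀ x y n d → x * y * n + d ≡ d + y * n * x
      reorder = solve-∀
      expand : b * n + d ≡ d + p ^ (a ∸ i) * n * p ^ i
      expand = trans (cong (λ z → z * n + d) (b≡p^k*p^[a∸k] i (<⇒≤ i<a)))
                     (reorder (p ^ i) (p ^ (a ∸ i)) n d)

  record State : Set where
    constructor state
    field
      low    : ℕ
      expo   : ℕ
      unit   : ℕ
      powers : ℕ → ℕ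
  open State

  record Tracks (n : ℕ) (s : State) : Set where
    field
      low≡    : low s % (a * b) ≡ n % (a * b)
      powers≡ : ∀ i → i < a → powers s i % b ≡ P ^ (n /p^ i) % b
      V F     : ℕ
      n!≡     : n ! ≡ p ^ V * F
      p∤F     : ¬ p ∣ F
      expo≡   : expo s % a ≡ V % a
      unit≡   : unit s % b ≡ F % b

  initial : State
  initial = state 0 0 1 (λ _ → 1)

  tracks-initial : Tracks 0 initial
  tracks-initial = record
    { low≡ = refl ; powers≡ = λ i _ → cong (λ z → P ^ z % b) (sym (0/n≡0 (p ^ i) {{p^≢0 i}}))
    ; V = 0 ; F = 1 ; n!≡ = refl ; p∤F = p∤1 ; expo≡ = refl ; unit≡ = refl }

  -- Reading the digit d: n ↦ b·n + d.
  next : State → ℕ → State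
  next (state r v f Y) d =
    state (b * r + d) (legendreSum a r d + v) (coprimeProductModel a r Y d * f)
          (λ i → P ^ (d /p^ i) * Y 0 ^ p ^ (a ∸ i))

  powers-next : ∀ n d Y₀ i → i < a → Y₀ % b ≡ P ^ n % b →
    (P ^ (d /p^ i) * Y₀ ^ p ^ (a ∸ i)) % b ≡ P ^ ((b * n + d) /p^ i) % b
  powers-next n d Y₀ i i<a Y₀≡ =
    trans (*-cong-% {d = b} {x = P ^ (d /p^ i)} refl (^-cong-% {d = b} (p ^ (a ∸ i)) Y₀≡))
    (cong (_% b) (sym (begin
      P ^ ((b * n + d) /p^ i)                ≡⟨ cong (P ^_) (quotient-step n d i i<a) ⟩
      P ^ (d /p^ i + p ^ (a ∸ i) * n)        ≡⟨ ^-distribˡ-+-* P (d /p^ i) _ ⟩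
      P ^ (d /p^ i) * P ^ (p ^ (a ∸ i) * n)  ≡⟨ cong (λ z → P ^ (d /p^ i) * P ^ z) (*-comm (p ^ (a ∸ i)) n) ⟩
      P ^ (d /p^ i) * P ^ (n * p ^ (a ∸ i))  ≡⟨ cong (P ^ (d /p^ i) *_) (^-*-assoc P n (p ^ (a ∸ i))) ⟨
      P ^ (d /p^ i) * (P ^ n) ^ p ^ (a ∸ i)  ∎)))
    where open ≡-Reasoning

  tracks-next : ∀ {n s} d → d < b → Tracks n s → Tracks (b * n + d) (next s d)
  tracks-next {n} {state r _ _ Y} d d<b T = record
    { low≡    = +-cong-% {d = a * b} (*-cong-% {d = a * b} {x = b} refl low≡) refl
    ; powers≡ = λ i i<a → powers-next n d (Y 0) i i<a
                  (trans (powers≡ 0 a≥1) (cong (λ z → P ^ z % b) (n/1≡n n)))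
    ; V       = legendreSum a n d + V
    ; F       = coprimeProduct a n d * F
    ; n!≡     = factorization
    ; p∤F     = p∤* (coprimeProduct-coprime a n d) p∤F
    ; expo≡   = +-cong-% {d = a} (sym (legendreSum-mod a n r d (%-cong-∣ (m∣m*n b) (sym low≡)))) expo≡
    ; unit≡   = *-cong-% {d = b}
                  (sym (coprimeProduct-mod a n r Y d ≤-refl d<b (%-cong-∣ (n∣m*n a) (sym low≡)) powers≡))
                  unit≡
    }
    where
      open Tracks T
      S = legendreSum a n d
      H = coprimeProduct a n d
      regroup : ∀ u v h f → u * (h * (v * f)) ≡ (u * v) * (h * f)
      regroup = solve-∀
      factorization : (b * n + d) ! ≡ p ^ (S + V) * (H * F)
      factorization = begin
        (b * n + d) !              ≡⟨ factorial-iterate a n d d<b ⟩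
        p ^ S * (H * n !)          ≡⟨ cong (λ z → p ^ S * (H * z)) n!≡ ⟩
        p ^ S * (H * (p ^ V * F))  ≡⟨ regroup (p ^ S) (p ^ V) H F ⟩
        p ^ S * p ^ V * (H * F)    ≡⟨ cong (_* (H * F)) (^-distribˡ-+-* p S V) ⟨
        p ^ (S + V) * (H * F)      ∎
        where open ≡-Reasoning

  output : State → ℕ
  output s = (p ^ (expo s % a) * unit s) % b

  output-correct : ∀ {n s} → Tracks n s → output s ≡ lastNZ b (n !)
  output-correct T =
    trans (*-cong-% {d = b} (cong (λ z → p ^ z % b) expo≡) unit≡)
          (sym (trans (cong (lastNZ b) n!≡) (lastNZ-factorization V F p∤F)))
    where open Tracks T

  codeCount : ℕ
  codeCount = (a * b) * (a * (b * b ^ a))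

  encode : State → Fin codeCount
  encode s = combine (residue (a * b) (low s)) (combine (residue a (expo s))
               (combine (residue b (unit s)) (pack a (powers s))))

  splitRest : Fin (a * (b * b ^ a)) → Fin a × (Fin b × Fin (b ^ a))
  splitRest c = map₂ (remQuot {b} (b ^ a)) (remQuot {a} (b * b ^ a) c)

  splitCode : Fin codeCount → Fin (a * b) × (Fin a × (Fin b × Fin (b ^ a)))
  splitCode c = map₂ splitRest (remQuot {a * b} (a * (b * b ^ a)) c)

  fromParts : Fin (a * b) × (Fin a × (Fin b × Fin (b ^ a))) → State
  fromParts (r , v , f , Y) = state (toℕ r) (toℕ v) (toℕ f) (unpack a Y)

  decode : Fin codeCount → State
  decode c = fromParts (splitCode c)

  splitCode-encode : ∀ s → splitCode (encode s) ≡
    (residue (a * b) (low s) , residue a (expo s) , residue b (unit s) , pack a (powers s))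
  splitCode-encode s =
    trans (cong (map₂ splitRest) (remQuot-combine r c))
          (cong (r ,_) (trans (cong (map₂ (remQuot {b} (b ^ a))) (remQuot-combine v c′))
                              (cong (v ,_) (remQuot-combine f Y))))
    where
      r = residue (a * b) (low s)
      v = residue a (expo s)
      f = residue b (unit s)
      Y = pack a (powers s)
      c′ = combine f Y
      c = combine v c′

  decode-encode : ∀ s → decode (encode s) ≡
    state (low s % (a * b)) (expo s % a) (unit s % b) (unpack a (pack a (powers s)))
  decode-encode s = trans (cong fromParts (splitCode-encode s))
    (cong₂ (λ r (vf : ℕ × ℕ) → state r (proj₁ vf) (proj₂ vf) (unpack a (pack a (powers s))))
           (toℕ-residue (a * b) (low s))
           (cong₂ _,_ (toℕ-residue a (expo s)) (toℕ-residue b (unit s))))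

  tracks-compress : ∀ {n s} → Tracks n s → Tracks n (decode (encode s))
  tracks-compress {s = s} T rewrite decode-encode s = record
    { low≡    = trans (m%n%n≡m%n (low s) (a * b)) low≡
    ; powers≡ = λ i i<a → trans (cong (_% b) (unpack-pack a (powers s) i i<a))
                                (trans (m%n%n≡m%n (powers s i) b) (powers≡ i i<a))
    ; V = V ; F = F ; n!≡ = n!≡ ; p∤F = p∤F
    ; expo≡   = trans (m%n%n≡m%n (expo s) a) expo≡
    ; unit≡   = trans (m%n%n≡m%n (unit s) b) unit≡
    }
    where open Tracks T

lemma3p6 : (p a : ℕ) (pr : Prime p) → a ≥ 1 →
    IsAutomatic (p ^ a) {{m^n≢0 p a {{prime⇒nonZero pr}}}}
      (λ n → lastNZ (p ^ a) {{m^n≢0 p a {{prime⇒nonZero pr}}}} (n !))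
lemma3p6 p a pr a≥1 =
  automatic-by-invariant codeCount encode decode (λ s d → next s (toℕ d)) initial output Tracks
    tracks-compress tracks-initial (λ d → tracks-next (toℕ d) (toℕ<n d)) output-correct
  where
    open PrimePower p a pr a≥1
    open Base b 1<b using (automatic-by-invariant)
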